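{- Let $\mathbf C$ be a category with a functor $|\cdot|:\mathbf C\to\mathbf{Set}$ and binary products, let $F:\mathbf C\to\mathbf C$ be a functor, and let $\lambda:\Psi\to\Psi F$ be an indexed morphism with $\lambda_X(\equiv_X)=\,\equiv_{FX}$ for all $X$. Assume the behavioural conformance exists: for every $F$-coalgebra $(X,\alpha)$ the set $\{R\in\Psi X\mid R\subseteq\alpha^*\lambda_XR\}$ has a greatest element $1^\lambda_X$, and $f^*(1^\lambda_Y)=1^\lambda_X$ for every coalgebra homomorphism $f:(X,\alpha)\to(Y,\beta)$. Let $\mathcal S:\mathbf C\to\mathbf A^{op}$ and $\mathcal T:\mathbf A^{op}\to\mathbf C$ be functors with $\mathcal S\dashv\mathcal T$, let $L:\mathbf A\to\mathbf A$ have an initial algebra $h:L\mathcal A\to\mathcal A$, and let $\delta:F\mathcal T\Rightarrow\mathcal T L$ be a natural transformation (components $\delta_B:F\mathcal T B\to\mathcal T LB$ in $\mathbf C$). If the functor $\mathrm{Eq}\circ\mathcal T:\mathbf A^{op}\to\int\Psi$ has a left adjoint, then the logic $(L,\delta)$ is adequate. Moreover, it is expressive if the function $|\delta_{\mathcal A}|$ is injective.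
   Context: Binary products in $\mathbf C$: $X\otimes Y$, projections $\pi_1^X,\pi_2^X:X\otimes X\to X$, $g\otimes g$ induced. $\Psi X$ = poset of subsets of $|X\otimes X|$; for $g:X\to Y$, $g^*(S)=|g\otimes g|^{ -1}(S)$. $\equiv_X=\langle|\pi_1^X|,|\pi_2^X|\rangle^{ -1}(\{(x,x)\mid x\in|X|\})$. $\int\Psi$ has objects $(X,R)$, $R\in\Psi X$, morphisms $g:(X,R)\to(Y,S)$ those $g:X\to Y$ with $R\subseteq g^*S$; $\mathrm{Eq}:\mathbf C\to\int\Psi$ is $X\mapsto(X,\equiv_X)$, $g\mapsto g$. An indexed morphism $\lambda:\Psi\to\Psi F$ is a family of monotone maps $\lambda_X:\Psi X\to\Psi FX$ with $\lambda_X(g^*S)=(Fg)^*\lambda_YS$. For a coalgebra $\alpha:X\to FX$ (in $\mathbf C$) the theory map $\mathrm{th}_X:X\to\mathcal T\mathcal A$ is the unique $\mathbf C$-morphism with $\mathcal T h\circ\mathrm{th}_X=\delta_{\mathcal A}\circ F(\mathrm{th}_X)\circ\alpha$ (it is the adjoint transpose of the initial-algebra semantics $\mathcal A\to\mathcal S X$). The logic $(L,\delta)$ is adequate if for every coalgebra $(X,\alpha)$, $\mathrm{th}_X$ is a morphism $(X,1^\lambda_X)\to(\mathcal T\mathcal A,\equiv_{\mathcal T\mathcal A})$ in $\int\Psi$, i.e. $1^\lambda_X\subseteq\mathrm{th}_X^*(\equiv_{\mathcal T\mathcal A})$; it is expressive if moreover this morphism is Cartesian, i.e. $1^\lambda_X=\mathrm{th}_X^*(\equiv_{\mathcal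 T\mathcal A})$. -}

module Defs where

open import Level using (Level; _⊔_) renaming (suc to lsuc)
open import Relation.Binary.PropositionalEquality as PE using (_≡_)
open import Relation.Binary.Structures using (IsEquivalence)
open import Data.Product using (Σ; _,_; proj₁; proj₂; _×_)
open import Relation.Unary using (Pred; _⊆_; _≐_)

record Category (o ℓ e : Level) : Set (lsuc (o ⊔ ℓ ⊔ e)) where
  infixr 9 _∘_
  infix 4 _≈_
  infixr 4 _⇒_
  field
    Obj : Set o
    _⇒_ : Obj → Obj → Set ℓ
    _≈_ : ∀ {A B} → A ⇒ B → A ⇒ B → Set e
    id : ∀ {A} → A ⇒ A
    _∘_ : ∀ {A B C} → B ⇒ C → A ⇒ B → A ⇒ C
    equiv : ∀ {A B} → IsEquivalence (_≈_ {A} {B})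
    ∘-resp-≈ : ∀ {A B C} {f h : B ⇒ C} {g i : A ⇒ B} →
               f ≈ h → g ≈ i → f ∘ g ≈ h ∘ i
    identityˡ : ∀ {A B} {f : A ⇒ B} → id ∘ f ≈ f
    identityʳ : ∀ {A B} {f : A ⇒ B} → f ∘ id ≈ f
    assoc : ∀ {A B C D} {f : A ⇒ B} {g : B ⇒ C} {h : C ⇒ D} →
            (h ∘ g) ∘ f ≈ h ∘ (g ∘ f)

  ≈-refl : ∀ {A B} {f : A ⇒ B} → f ≈ f
  ≈-refl = IsEquivalence.refl equiv
  ≈-sym : ∀ {A B} {f g : A ⇒ B} → f ≈ g → g ≈ f
  ≈-sym = IsEquivalence.sym equiv
  ≈-trans : ∀ {A B} {f g h : A ⇒ B} → f ≈ g → g ≈ h → f ≈ h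
  ≈-trans = IsEquivalence.trans equiv

op : ∀ {o ℓ e} → Category o ℓ e → Category o ℓ e
op C = record
  { Obj = Obj
  ; _⇒_ = λ A B → B ⇒ A
  ; _≈_ = _≈_
  ; id = id
  ; _∘_ = λ f g → g ∘ f
  ; equiv = equiv
  ; ∘-resp-≈ = λ p q → ∘-resp-≈ q p
  ; identityˡ = identityʳ
  ; identityʳ = identityˡ
  ; assoc = ≈-sym assoc
  }
  where open Category C

record Functor {o ℓ e o′ ℓ′ e′ : Level} (C : Category o ℓ e) (D : Category o′ ℓ′ e′)
       : Set (o ⊔ ℓ ⊔ e ⊔ o′ ⊔ ℓ′ ⊔ e′) where
  private
    module C = Category C
    module D = Category D
  field
    F₀ : C.Obj → D.Obj
    F₁ : ∀ {A B} → A C.⇒ B → F₀ A D.⇒ F₀ B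
    identity : ∀ {A} → F₁ (C.id {A}) D.≈ D.id
    homomorphism : ∀ {X Y Z} {f : X C.⇒ Y} {g : Y C.⇒ Z} →
                   F₁ (g C.∘ f) D.≈ F₁ g D.∘ F₁ f
    F-resp-≈ : ∀ {A B} {f g : A C.⇒ B} → f C.≈ g → F₁ f D.≈ F₁ g

idF : ∀ {o ℓ e} {C : Category o ℓ e} → Functor C C
idF {C = C} = record
  { F₀ = λ X → X ; F₁ = λ f → f ; identity = ≈-refl
  ; homomorphism = ≈-refl ; F-resp-≈ = λ p → p }
  where open Category C

infixr 9 _∘F_
_∘F_ : ∀ {o ℓ e o′ ℓ′ e′ o″ ℓ″ e″}
         {C : Category o ℓ e} {D : Category o′ ℓ′ e′} {E : Category o″ ℓ″ e″} →
       Functor D E → Functor C D → Functor C E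
_∘F_ {C = C} {D} {E} G F = record
  { F₀ = λ X → G.F₀ (F.F₀ X)
  ; F₁ = λ f → G.F₁ (F.F₁ f)
  ; identity = E.≈-trans (G.F-resp-≈ F.identity) G.identity
  ; homomorphism = E.≈-trans (G.F-resp-≈ F.homomorphism) G.homomorphism
  ; F-resp-≈ = λ p → G.F-resp-≈ (F.F-resp-≈ p)
  }
  where
    module G = Functor G
    module F = Functor F
    module E = Category E

opF : ∀ {o ℓ e o′ ℓ′ e′} {C : Category o ℓ e} {D : Category o′ ℓ′ e′} →
      Functor C D → Functor (op C) (op D)
opF {D = D} F = record
  { F₀ = F₀ ; F₁ = F₁ ; identity = identity
  ; homomorphism = homomorphism ; F-resp-≈ = F-resp-≈ }
  where open Functor F

record NaturalTransformation {o ℓ e o′ ℓ′ e′ : Level}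
       {C : Category o ℓ e} {D : Category o′ ℓ′ e′} (F G : Functor C D)
       : Set (o ⊔ ℓ ⊔ e ⊔ o′ ⊔ ℓ′ ⊔ e′) where
  private
    module C = Category C
    module D = Category D
    module F = Functor F
    module G = Functor G
  field
    η : ∀ X → F.F₀ X D.⇒ G.F₀ X
    commute : ∀ {X Y} (f : X C.⇒ Y) → G.F₁ f D.∘ η X D.≈ η Y D.∘ F.F₁ f

record _⊣_ {o ℓ e o′ ℓ′ e′ : Level} {C : Category o ℓ e} {D : Category o′ ℓ′ e′}
       (L : Functor C D) (R : Functor D C) : Set (o ⊔ ℓ ⊔ e ⊔ o′ ⊔ ℓ′ ⊔ e′) where
  private
    module C = Category C
    module D = Category D
    module L = Functor L
    module R = Functor R
  field
    unit : NaturalTransformation idF (R ∘F L)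
    counit : NaturalTransformation (L ∘F R) idF
    zig : ∀ {A} → NaturalTransformation.η counit (L.F₀ A) D.∘ L.F₁ (NaturalTransformation.η unit A) D.≈ D.id
    zag : ∀ {B} → R.F₁ (NaturalTransformation.η counit B) C.∘ NaturalTransformation.η unit (R.F₀ B) C.≈ C.id

HasLeftAdjoint : ∀ {o ℓ e o′ ℓ′ e′} {C : Category o ℓ e} {D : Category o′ ℓ′ e′} →
                 Functor D C → Set (o ⊔ ℓ ⊔ e ⊔ o′ ⊔ ℓ′ ⊔ e′)
HasLeftAdjoint {C = C} {D} G = Σ (Functor C D) (λ L → L ⊣ G)

record InitialAlgebra {o ℓ e} {A : Category o ℓ e} (L : Functor A A) : Set (o ⊔ ℓ ⊔ e) where
  open Category A
  open Functor L
  field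
    𝒜 : Obj
    h : F₀ 𝒜 ⇒ 𝒜
    fold : ∀ {B} → F₀ B ⇒ B → 𝒜 ⇒ B
    fold-hom : ∀ {B} (b : F₀ B ⇒ B) → fold b ∘ h ≈ b ∘ F₁ (fold b)
    fold-unique : ∀ {B} (b : F₀ B ⇒ B) (g : 𝒜 ⇒ B) → g ∘ h ≈ b ∘ F₁ g → g ≈ fold b

record SetFunctor {o ℓ e} (C : Category o ℓ e) (c : Level) : Set (o ⊔ ℓ ⊔ e ⊔ lsuc c) where
  open Category C
  field
    ∣_∣ : Obj → Set c
    map : ∀ {A B} → A ⇒ B → ∣ A ∣ → ∣ B ∣
    map-id : ∀ {A} (x : ∣ A ∣) → map (id {A}) x ≡ x
    map-∘ : ∀ {A B D} (f : A ⇒ B) (g : B ⇒ D) (x : ∣ A ∣) → map (g ∘ f) x ≡ map g (map f x)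
    map-resp : ∀ {A B} {f g : A ⇒ B} → f ≈ g → (x : ∣ A ∣) → map f x ≡ map g x

record BinaryProducts {o ℓ e} (C : Category o ℓ e) : Set (o ⊔ ℓ ⊔ e) where
  open Category C
  infixr 7 _⊗_
  field
    _⊗_ : Obj → Obj → Obj
    π₁ : ∀ {A B} → A ⊗ B ⇒ A
    π₂ : ∀ {A B} → A ⊗ B ⇒ B
    ⟨_,_⟩ : ∀ {X A B} → X ⇒ A → X ⇒ B → X ⇒ A ⊗ B
    project₁ : ∀ {X A B} {f : X ⇒ A} {g : X ⇒ B} → π₁ ∘ ⟨ f , g ⟩ ≈ f
    project₂ : ∀ {X A B} {f : X ⇒ A} {g : X ⇒ B} → π₂ ∘ ⟨ f , g ⟩ ≈ g
    unique : ∀ {X A B} {h : X ⇒ A ⊗ B} {f : X ⇒ A} {g : X ⇒ B} →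
             π₁ ∘ h ≈ f → π₂ ∘ h ≈ g → ⟨ f , g ⟩ ≈ h

module Setup {o ℓ e c} (C : Category o ℓ e) (U : SetFunctor C c) (P : BinaryProducts C)
             (F : Functor C C) where
  open Category C
  open SetFunctor U
  open BinaryProducts P
  open Functor F

  _⊗₁ : ∀ {X Y} → X ⇒ Y → X ⊗ X ⇒ Y ⊗ Y
  g ⊗₁ = ⟨ g ∘ π₁ , g ∘ π₂ ⟩

  Ψ : Obj → Set (lsuc c)
  Ψ X = Pred ∣ X ⊗ X ∣ c

  _* : ∀ {X Y} → X ⇒ Y → Ψ Y → Ψ X
  (g *) S z = S (map (g ⊗₁) z)

  ≡[_] : ∀ X → Ψ X
  ≡[ X ] z = map π₁ z ≡ map π₂ z

  record IndexedMorphism : Set (o ⊔ ℓ ⊔ lsuc (lsuc c)) where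
    field
      λ₀ : ∀ X → Ψ X → Ψ (F₀ X)
      monotone : ∀ {X} {R S : Ψ X} → R ⊆ S → λ₀ X R ⊆ λ₀ X S
      natural : ∀ {X Y} (g : X ⇒ Y) (S : Ψ Y) → λ₀ X ((g *) S) ≐ (F₁ g *) (λ₀ Y S)

  IsCoalgHom : ∀ {X Y} → X ⇒ F₀ X → Y ⇒ F₀ Y → X ⇒ Y → Set e
  IsCoalgHom α β f = F₁ f ∘ α ≈ β ∘ f

  record Conformance (λ' : IndexedMorphism) : Set (o ⊔ ℓ ⊔ e ⊔ lsuc c) where
    open IndexedMorphism λ'
    field
      𝟙 : ∀ {X} → X ⇒ F₀ X → Ψ X
      postfixed : ∀ {X} (α : X ⇒ F₀ X) → 𝟙 α ⊆ (α *) (λ₀ X (𝟙 α))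
      greatest : ∀ {X} (α : X ⇒ F₀ X) (R : Ψ X) → R ⊆ (α *) (λ₀ X R) → R ⊆ 𝟙 α
      hom-stable : ∀ {X Y} (α : X ⇒ F₀ X) (β : Y ⇒ F₀ Y) (f : X ⇒ Y) →
                   IsCoalgHom α β f → (f *) (𝟙 β) ≐ 𝟙 α

  private
    ⟨⟩-cong : ∀ {X A B} {f f′ : X ⇒ A} {g g′ : X ⇒ B} → f ≈ f′ → g ≈ g′ → ⟨ f , g ⟩ ≈ ⟨ f′ , g′ ⟩
    ⟨⟩-cong p q = unique (≈-trans project₁ (≈-sym p)) (≈-trans project₂ (≈-sym q))

    ⟨⟩∘ : ∀ {Y X A B} {f : X ⇒ A} {g : X ⇒ B} {k : Y ⇒ X} → ⟨ f , g ⟩ ∘ k ≈ ⟨ f ∘ k , g ∘ k ⟩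
    ⟨⟩∘ = ≈-sym (unique (≈-trans (≈-sym assoc) (∘-resp-≈ project₁ ≈-refl))
                        (≈-trans (≈-sym assoc) (∘-resp-≈ project₂ ≈-refl)))

    id⊗ : ∀ {X} → (id {X}) ⊗₁ ≈ id
    id⊗ = unique (≈-trans identityʳ (≈-sym identityˡ)) (≈-trans identityʳ (≈-sym identityˡ))

    ⊗∘ : ∀ {X Y Z} {g : X ⇒ Y} {k : Y ⇒ Z} → (k ∘ g) ⊗₁ ≈ (k ⊗₁) ∘ (g ⊗₁)
    ⊗∘ {g = g} {k} = ≈-sym (≈-trans ⟨⟩∘ (⟨⟩-cong
      (≈-trans assoc (≈-trans (∘-resp-≈ ≈-refl project₁) (≈-sym assoc)))
      (≈-trans assoc (≈-trans (∘-resp-≈ ≈-refl project₂) (≈-sym assoc)))))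

  ∫Ψ : Category (o ⊔ lsuc c) (ℓ ⊔ c) e
  ∫Ψ = record
    { Obj = Σ Obj Ψ
    ; _⇒_ = λ XR YS → Σ (proj₁ XR ⇒ proj₁ YS) (λ g → proj₂ XR ⊆ (g *) (proj₂ YS))
    ; _≈_ = λ f g → proj₁ f ≈ proj₁ g
    ; id = λ {XR} → id , λ {z} r → PE.subst (proj₂ XR) (PE.sym (PE.trans (map-resp id⊗ z) (map-id z))) r
    ; _∘_ = λ {XR} {YS} {ZT} f g → proj₁ f ∘ proj₁ g , λ {z} r →
        PE.subst (proj₂ ZT)
          (PE.sym (PE.trans (map-resp ⊗∘ z) (map-∘ (proj₁ g ⊗₁) (proj₁ f ⊗₁) z)))
          (proj₂ f (proj₂ g r))
    ; equiv = record { refl = ≈-refl ; sym = ≈-sym ; trans = ≈-trans }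
    ; ∘-resp-≈ = ∘-resp-≈
    ; identityˡ = identityˡ
    ; identityʳ = identityʳ
    ; assoc = assoc
    }

  Eq : Functor C ∫Ψ
  Eq = record
    { F₀ = λ X → X , ≡[ X ]
    ; F₁ = λ g → g , λ {z} p →
        PE.trans (PE.sym (map-∘ (g ⊗₁) π₁ z))
        (PE.trans (map-resp project₁ z)
        (PE.trans (map-∘ π₁ g z)
        (PE.trans (PE.cong (map g) p)
        (PE.trans (PE.sym (map-∘ π₂ g z))
        (PE.trans (PE.sym (map-resp project₂ z))
        (map-∘ (g ⊗₁) π₂ z))))))
    ; identity = ≈-refl
    ; homomorphism = ≈-refl
    ; F-resp-≈ = λ p → p
    }

  module Logic {oa ℓa ea} {A : Category oa ℓa ea} (T : Functor (op A) C)
               (L : Functor A A) (I : InitialAlgebra L)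
               (δ : NaturalTransformation (F ∘F T) (T ∘F opF L)) where
    private
      module T = Functor T
      module I = InitialAlgebra I
      module δ = NaturalTransformation δ

    IsTheoryMap : ∀ {X} → X ⇒ F₀ X → X ⇒ T.F₀ I.𝒜 → Set e
    IsTheoryMap α th = T.F₁ I.h ∘ th ≈ δ.η I.𝒜 ∘ (F₁ th ∘ α)

    Adequate : (λ' : IndexedMorphism) → Conformance λ' → Set (o ⊔ ℓ ⊔ e ⊔ c)
    Adequate λ' K = ∀ {X} (α : X ⇒ F₀ X) (th : X ⇒ T.F₀ I.𝒜) → IsTheoryMap α th →
                    Conformance.𝟙 K α ⊆ (th *) ≡[ T.F₀ I.𝒜 ]

    Expressive : (λ' : IndexedMorphism) → Conformance λ' → Set (o ⊔ ℓ ⊔ e ⊔ c)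
    Expressive λ' K = ∀ {X} (α : X ⇒ F₀ X) (th : X ⇒ T.F₀ I.𝒜) → IsTheoryMap α th →
                      Conformance.𝟙 K α ≐ (th *) ≡[ T.F₀ I.𝒜 ]

{-# OPTIONS --safe #-}
-- Let G be the left adjoint of Eq ∘ T. For a λ-postfixed relation R on a coalgebra α, the map
-- δ ∘ F η ∘ α (η the unit at (X, R)) respects R, so it is a morphism (X, R) → Eq (T (L (G (X, R))))
-- in ∫Ψ whose transpose is an L-algebra on G (X, R). Folding the initial algebra into it gives a
-- theory map whose kernel contains R, and the universal property of the transpose makes every theory
-- map that respects R equal to it. Taking R empty shows that theory maps are unique, and taking
-- R = 1^λ gives adequacy. Conversely, when |δ_𝒜| is injective the kernel of a theory map is
-- λ-postfixed, hence contained in 1^λ.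
module Submission where

open import Defs
open import Level using (Lift)
open import Data.Empty using (⊥)
open import Data.Product using (_×_; _,_; proj₁; proj₂)
open import Relation.Unary using (_≐_; _⊆_)
open import Relation.Binary.Bundles using (Setoid)
open import Relation.Binary.PropositionalEquality as PE using (_≡_; subst₂)
open import Function.Definitions using (Injective)

module HomReasoning {o ℓ e} (C : Category o ℓ e) where
  open Category C

  hom-setoid : Obj → Obj → Setoid ℓ e
  hom-setoid A B = record { Carrier = A ⇒ B ; _≈_ = _≈_ ; isEquivalence = equiv }

  module _ {A B : Obj} where
    open import Relation.Binary.Reasoning.Setoid (hom-setoid A B) public

  ∘-resp-≈ˡ : ∀ {A B D} {f h : B ⇒ D} {g : A ⇒ B} → f ≈ h → f ∘ g ≈ h ∘ g
  ∘-resp-≈ˡ p = ∘-resp-≈ p ≈-refl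

  ∘-resp-≈ʳ : ∀ {A B D} {f : B ⇒ D} {g i : A ⇒ B} → g ≈ i → f ∘ g ≈ f ∘ i
  ∘-resp-≈ʳ p = ∘-resp-≈ ≈-refl p

module Transpose {o ℓ e o′ ℓ′ e′} {C : Category o ℓ e} {D : Category o′ ℓ′ e′}
                 {G : Functor C D} {R : Functor D C} (adj : G ⊣ R) where
  private
    module C = Category C
    module D = Category D
    module G = Functor G
    module R = Functor R
    open _⊣_ adj
    module η = NaturalTransformation unit
    module ε = NaturalTransformation counit

  transpose : ∀ {X B} → X C.⇒ R.F₀ B → G.F₀ X D.⇒ B
  transpose {B = B} f = ε.η B D.∘ G.F₁ f

  transpose-triangle : ∀ {X B} (f : X C.⇒ R.F₀ B) → R.F₁ (transpose f) C.∘ η.η X C.≈ f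
  transpose-triangle {X} {B} f = begin
    R.F₁ (ε.η B D.∘ G.F₁ f) C.∘ η.η X        ≈⟨ ∘-resp-≈ˡ R.homomorphism ⟩
    (R.F₁ (ε.η B) C.∘ R.F₁ (G.F₁ f)) C.∘ η.η X ≈⟨ C.assoc ⟩
    R.F₁ (ε.η B) C.∘ (R.F₁ (G.F₁ f) C.∘ η.η X) ≈⟨ ∘-resp-≈ʳ (η.commute f) ⟩
    R.F₁ (ε.η B) C.∘ (η.η (R.F₀ B) C.∘ f)     ≈⟨ C.≈-sym C.assoc ⟩
    (R.F₁ (ε.η B) C.∘ η.η (R.F₀ B)) C.∘ f     ≈⟨ ∘-resp-≈ˡ zag ⟩
    C.id C.∘ f                                 ≈⟨ C.identityˡ ⟩
    f                                          ∎
    where open HomReasoning C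

  transpose-R∘unit : ∀ {X B} (g : G.F₀ X D.⇒ B) → transpose (R.F₁ g C.∘ η.η X) D.≈ g
  transpose-R∘unit {X} {B} g = begin
    ε.η B D.∘ G.F₁ (R.F₁ g C.∘ η.η X)                ≈⟨ ∘-resp-≈ʳ G.homomorphism ⟩
    ε.η B D.∘ (G.F₁ (R.F₁ g) D.∘ G.F₁ (η.η X))       ≈⟨ D.≈-sym D.assoc ⟩
    (ε.η B D.∘ G.F₁ (R.F₁ g)) D.∘ G.F₁ (η.η X)       ≈⟨ ∘-resp-≈ˡ (D.≈-sym (ε.commute g)) ⟩
    (g D.∘ ε.η (G.F₀ X)) D.∘ G.F₁ (η.η X)            ≈⟨ D.assoc ⟩
    g D.∘ (ε.η (G.F₀ X) D.∘ G.F₁ (η.η X))            ≈⟨ ∘-resp-≈ʳ zig ⟩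
    g D.∘ D.id                                        ≈⟨ D.identityʳ ⟩
    g                                                 ∎
    where open HomReasoning D

  unit-cancel : ∀ {X B} {g g′ : G.F₀ X D.⇒ B} →
                R.F₁ g C.∘ η.η X C.≈ R.F₁ g′ C.∘ η.η X → g D.≈ g′
  unit-cancel {g = g} {g′} p = begin
    g                            ≈⟨ D.≈-sym (transpose-R∘unit g) ⟩
    transpose (R.F₁ g C.∘ _)     ≈⟨ ∘-resp-≈ʳ (G.F-resp-≈ p) ⟩
    transpose (R.F₁ g′ C.∘ _)    ≈⟨ transpose-R∘unit g′ ⟩
    g′                           ∎
    where open HomReasoning D

module Kernels {o ℓ e c} (C : Category o ℓ e) (U : SetFunctor C c) (P : BinaryProducts C)
               (F : Functor C C) where
  open Setup C U P F
  open Category C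
  open SetFunctor U
  open BinaryProducts P
  open Functor F

  Ker : ∀ {X Y} → X ⇒ Y → Ψ X
  Ker g z = map g (map π₁ z) ≡ map g (map π₂ z)

  map-π₁-⊗ : ∀ {X Y} (g : X ⇒ Y) z → map π₁ (map (g ⊗₁) z) ≡ map g (map π₁ z)
  map-π₁-⊗ g z =
    PE.trans (PE.sym (map-∘ (g ⊗₁) π₁ z)) (PE.trans (map-resp project₁ z) (map-∘ π₁ g z))

  map-π₂-⊗ : ∀ {X Y} (g : X ⇒ Y) z → map π₂ (map (g ⊗₁) z) ≡ map g (map π₂ z)
  map-π₂-⊗ g z =
    PE.trans (PE.sym (map-∘ (g ⊗₁) π₂ z)) (PE.trans (map-resp project₂ z) (map-∘ π₂ g z))

  *≡≐Ker : ∀ {X Y} (g : X ⇒ Y) → (g *) ≡[ Y ] ≐ Ker g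
  *≡≐Ker g = (λ {z} → subst₂ _≡_ (map-π₁-⊗ g z) (map-π₂-⊗ g z))
           , (λ {z} → subst₂ _≡_ (PE.sym (map-π₁-⊗ g z)) (PE.sym (map-π₂-⊗ g z)))

  *-Ker : ∀ {X Y Z} (f : X ⇒ Y) (g : Y ⇒ Z) → (f *) (Ker g) ≐ Ker (g ∘ f)
  *-Ker f g = (λ {z} → subst₂ _≡_ (on₁ z) (on₂ z))
            , (λ {z} → subst₂ _≡_ (PE.sym (on₁ z)) (PE.sym (on₂ z)))
    where
      on₁ : ∀ z → map g (map π₁ (map (f ⊗₁) z)) ≡ map (g ∘ f) (map π₁ z)
      on₁ z = PE.trans (PE.cong (map g) (map-π₁-⊗ f z)) (PE.sym (map-∘ f g (map π₁ z)))

      on₂ : ∀ z → map g (map π₂ (map (f ⊗₁) z)) ≡ map (g ∘ f) (map π₂ z)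
      on₂ z = PE.trans (PE.cong (map g) (map-π₂-⊗ f z)) (PE.sym (map-∘ f g (map π₂ z)))

  Ker-resp-≈ : ∀ {X Y} {f f′ : X ⇒ Y} → f ≈ f′ → Ker f ⊆ Ker f′
  Ker-resp-≈ f≈f′ {z} = subst₂ _≡_ (map-resp f≈f′ (map π₁ z)) (map-resp f≈f′ (map π₂ z))

  Ker-∘ : ∀ {X Y Z} (f : X ⇒ Y) (g : Y ⇒ Z) → Ker f ⊆ Ker (g ∘ f)
  Ker-∘ f g {z} p = subst₂ _≡_ (PE.sym (map-∘ f g (map π₁ z))) (PE.sym (map-∘ f g (map π₂ z)))
                             (PE.cong (map g) p)

  Ker-∘-injective : ∀ {X Y Z} (f : X ⇒ Y) {g : Y ⇒ Z} → Injective _≡_ _≡_ (map g) →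
                    Ker (g ∘ f) ⊆ Ker f
  Ker-∘-injective f {g} g-inj {z} p =
    g-inj (subst₂ _≡_ (map-∘ f g (map π₁ z)) (map-∘ f g (map π₂ z)) p)

  module _ (λ' : IndexedMorphism) (λ-≡ : ∀ X → IndexedMorphism.λ₀ λ' X ≡[ X ] ≐ ≡[ F₀ X ]) where
    open IndexedMorphism λ'

    λ-Ker : ∀ {X Y} (g : X ⇒ Y) → λ₀ X (Ker g) ≐ Ker (F₁ g)
    λ-Ker {Y = Y} g =
        (λ p → proj₁ (*≡≐Ker (F₁ g)) (proj₁ (λ-≡ Y) (proj₁ (natural g ≡[ Y ])
                 (monotone (proj₂ (*≡≐Ker g)) p))))
      , (λ p → monotone (proj₁ (*≡≐Ker g)) (proj₂ (natural g ≡[ Y ])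
                 (proj₂ (λ-≡ Y) (proj₂ (*≡≐Ker (F₁ g)) p))))

    Ker-F∘ : ∀ {X Y} {α : X ⇒ F₀ X} {R : Ψ X} (f : X ⇒ Y) →
             R ⊆ (α *) (λ₀ X R) → R ⊆ Ker f → R ⊆ Ker (F₁ f ∘ α)
    Ker-F∘ {α = α} f R-postfixed R⊆Ker r =
      proj₁ (*-Ker α (F₁ f)) (proj₁ (λ-Ker f) (monotone R⊆Ker (R-postfixed r)))

    Ker-postfixed : ∀ {X Y} {α : X ⇒ F₀ X} (f : X ⇒ Y) →
                    Ker (F₁ f ∘ α) ⊆ (α *) (λ₀ X (Ker f))
    Ker-postfixed {α = α} f p = proj₂ (λ-Ker f) (proj₂ (*-Ker α (F₁ f)) p)

module TheoryMaps {o ℓ e c oa ℓa ea}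
  (C : Category o ℓ e) (U : SetFunctor C c) (P : BinaryProducts C) (F : Functor C C)
  {A : Category oa ℓa ea} (T : Functor (op A) C) (L : Functor A A) (I : InitialAlgebra L)
  (δ : NaturalTransformation (F ∘F T) (T ∘F opF L)) where
  open Setup C U P F
  open Logic T L I δ
  open Kernels C U P F
  open Category C
  open SetFunctor U
  open HomReasoning C
  private
    module F = Functor F
    module T = Functor T
    module L = Functor L
    module I = InitialAlgebra I
    module δ = NaturalTransformation δ
    module Aᵒ = Category (op A)

  next : ∀ {X B} → X ⇒ F.F₀ X → X ⇒ T.F₀ B → X ⇒ T.F₀ (L.F₀ B)
  next {B = B} α f = δ.η B ∘ (F.F₁ f ∘ α)

  next-natural : ∀ {X B B′} (α : X ⇒ F.F₀ X) (f : X ⇒ T.F₀ B) (t : B Aᵒ.⇒ B′) →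
                 T.F₁ (L.F₁ t) ∘ next α f ≈ next α (T.F₁ t ∘ f)
  next-natural {B = B} {B′} α f t = begin
    T.F₁ (L.F₁ t) ∘ (δ.η B ∘ (F.F₁ f ∘ α))       ≈⟨ ≈-sym assoc ⟩
    (T.F₁ (L.F₁ t) ∘ δ.η B) ∘ (F.F₁ f ∘ α)       ≈⟨ ∘-resp-≈ˡ (δ.commute t) ⟩
    (δ.η B′ ∘ F.F₁ (T.F₁ t)) ∘ (F.F₁ f ∘ α)      ≈⟨ assoc ⟩
    δ.η B′ ∘ (F.F₁ (T.F₁ t) ∘ (F.F₁ f ∘ α))      ≈⟨ ∘-resp-≈ʳ (≈-sym assoc) ⟩
    δ.η B′ ∘ ((F.F₁ (T.F₁ t) ∘ F.F₁ f) ∘ α)      ≈⟨ ∘-resp-≈ʳ (∘-resp-≈ˡ (≈-sym F.homomorphism)) ⟩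
    δ.η B′ ∘ (F.F₁ (T.F₁ t ∘ f) ∘ α)             ∎

  next-resp-≈ : ∀ {X B} (α : X ⇒ F.F₀ X) {f f′ : X ⇒ T.F₀ B} → f ≈ f′ → next α f ≈ next α f′
  next-resp-≈ α f≈f′ = ∘-resp-≈ʳ (∘-resp-≈ˡ (F.F-resp-≈ f≈f′))

  module _ (λ' : IndexedMorphism) (λ-≡ : ∀ X → IndexedMorphism.λ₀ λ' X ≡[ X ] ≐ ≡[ F.F₀ X ]) where
    open IndexedMorphism λ'

    Ker-theoryMap-postfixed : Injective _≡_ _≡_ (map (δ.η I.𝒜)) →
                              ∀ {X} {α : X ⇒ F.F₀ X} {th : X ⇒ T.F₀ I.𝒜} → IsTheoryMap α th →
                              Ker th ⊆ (α *) (λ₀ X (Ker th))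
    Ker-theoryMap-postfixed δ-inj {α = α} {th} th-eq p =
      Ker-postfixed λ' λ-≡ th
        (Ker-∘-injective (F.F₁ th ∘ α) δ-inj
          (Ker-resp-≈ th-eq (Ker-∘ th (T.F₁ I.h) p)))

    Ker-theoryMap⊆𝟙 : (K : Conformance λ') → Injective _≡_ _≡_ (map (δ.η I.𝒜)) →
                      ∀ {X} (α : X ⇒ F.F₀ X) {th : X ⇒ T.F₀ I.𝒜} → IsTheoryMap α th →
                      (th *) ≡[ T.F₀ I.𝒜 ] ⊆ Conformance.𝟙 K α
    Ker-theoryMap⊆𝟙 K δ-inj α {th} th-eq = Conformance.greatest K α _ λ p →
      monotone (proj₂ (*≡≐Ker th)) (Ker-theoryMap-postfixed δ-inj th-eq (proj₁ (*≡≐Ker th) p))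

    module _ {G : Functor ∫Ψ (op A)} (adj : G ⊣ (Eq ∘F T)) where
      open Transpose adj
      private
        module G = Functor G
        module unit = NaturalTransformation (_⊣_.unit adj)

      module _ {X} {α : X ⇒ F.F₀ X} {R : Ψ X} (R-postfixed : R ⊆ (α *) (λ₀ X R)) where
        private
          GQ : Aᵒ.Obj
          GQ = G.F₀ (X , R)

          η : X ⇒ T.F₀ GQ
          η = proj₁ (unit.η (X , R))

          R⊆Ker-η : R ⊆ Ker η
          R⊆Ker-η r = proj₁ (*≡≐Ker η) (proj₂ (unit.η (X , R)) r)

        algebra : GQ Aᵒ.⇒ L.F₀ GQ
        algebra = transpose (next α η , λ r → proj₂ (*≡≐Ker (next α η))
          (Ker-∘ (F.F₁ η ∘ α) (δ.η GQ) (Ker-F∘ λ' λ-≡ η R-postfixed R⊆Ker-η r)))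

        algebra-next : ∀ {B} (t : GQ Aᵒ.⇒ B) → T.F₁ (L.F₁ t Aᵒ.∘ algebra) ∘ η ≈ next α (T.F₁ t ∘ η)
        algebra-next t = begin
          T.F₁ (L.F₁ t Aᵒ.∘ algebra) ∘ η           ≈⟨ ∘-resp-≈ˡ T.homomorphism ⟩
          (T.F₁ (L.F₁ t) ∘ T.F₁ algebra) ∘ η      ≈⟨ assoc ⟩
          T.F₁ (L.F₁ t) ∘ (T.F₁ algebra ∘ η)      ≈⟨ ∘-resp-≈ʳ (transpose-triangle _) ⟩
          T.F₁ (L.F₁ t) ∘ next α η                ≈⟨ next-natural α η t ⟩
          next α (T.F₁ t ∘ η)                     ∎

        theoryMap : X ⇒ T.F₀ I.𝒜
        theoryMap = T.F₁ (I.fold algebra) ∘ η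

        theoryMap-isTheoryMap : IsTheoryMap α theoryMap
        theoryMap-isTheoryMap = begin
          T.F₁ I.h ∘ (T.F₁ (I.fold algebra) ∘ η)                ≈⟨ ≈-sym assoc ⟩
          (T.F₁ I.h ∘ T.F₁ (I.fold algebra)) ∘ η                ≈⟨ ∘-resp-≈ˡ (≈-sym T.homomorphism) ⟩
          T.F₁ (I.h Aᵒ.∘ I.fold algebra) ∘ η                    ≈⟨ ∘-resp-≈ˡ (T.F-resp-≈ (I.fold-hom algebra)) ⟩
          T.F₁ (L.F₁ (I.fold algebra) Aᵒ.∘ algebra) ∘ η         ≈⟨ algebra-next (I.fold algebra) ⟩
          next α theoryMap                                      ∎

        theoryMap-respects : R ⊆ (theoryMap *) ≡[ T.F₀ I.𝒜 ]
        theoryMap-respects r = proj₂ (*≡≐Ker theoryMap) (Ker-∘ η (T.F₁ (I.fold algebra)) (R⊆Ker-η r))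

        theoryMap-unique : ∀ {th} → IsTheoryMap α th → R ⊆ (th *) ≡[ T.F₀ I.𝒜 ] → th ≈ theoryMap
        theoryMap-unique {th} th-eq th-respects = begin
          th                    ≈⟨ ≈-sym t≈th ⟩
          T.F₁ t ∘ η            ≈⟨ ∘-resp-≈ˡ (T.F-resp-≈ (I.fold-unique algebra t t-hom)) ⟩
          theoryMap             ∎
          where
            t : GQ Aᵒ.⇒ I.𝒜
            t = transpose (th , th-respects)

            t≈th : T.F₁ t ∘ η ≈ th
            t≈th = transpose-triangle (th , th-respects)

            t-hom : I.h Aᵒ.∘ t Aᵒ.≈ L.F₁ t Aᵒ.∘ algebra
            t-hom = unit-cancel (begin
              T.F₁ (I.h Aᵒ.∘ t) ∘ η         ≈⟨ ∘-resp-≈ˡ T.homomorphism ⟩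
              (T.F₁ I.h ∘ T.F₁ t) ∘ η       ≈⟨ assoc ⟩
              T.F₁ I.h ∘ (T.F₁ t ∘ η)       ≈⟨ ∘-resp-≈ʳ t≈th ⟩
              T.F₁ I.h ∘ th                 ≈⟨ th-eq ⟩
              next α th                     ≈⟨ next-resp-≈ α (≈-sym t≈th) ⟩
              next α (T.F₁ t ∘ η)           ≈⟨ ≈-sym (algebra-next t) ⟩
              T.F₁ (L.F₁ t Aᵒ.∘ algebra) ∘ η ∎)

      -- IsTheoryMap records only the defining equation; uniqueness comes from the empty relation.
      theoryMaps-unique : ∀ {X} {α : X ⇒ F.F₀ X} {th th′ : X ⇒ T.F₀ I.𝒜} →
                          IsTheoryMap α th → IsTheoryMap α th′ → th ≈ th′
      theoryMaps-unique th-eq th′-eq =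
        ≈-trans (theoryMap-unique ∅-postfixed th-eq (λ ()))
                (≈-sym (theoryMap-unique ∅-postfixed th′-eq (λ ())))
        where
          ∅ : ∀ {X} → Ψ X
          ∅ _ = Lift c ⊥

          ∅-postfixed : ∀ {X} {α : X ⇒ F.F₀ X} → ∅ ⊆ (α *) (λ₀ X ∅)
          ∅-postfixed ()

      adequate : (K : Conformance λ') → Adequate λ' K
      adequate K α _ th-eq r =
        proj₂ (*≡≐Ker _) (Ker-resp-≈ (theoryMaps-unique (theoryMap-isTheoryMap post) th-eq)
                                     (proj₁ (*≡≐Ker _) (theoryMap-respects post r)))
        where post = Conformance.postfixed K α

theorem3 : ∀ {o ℓ e c oa ℓa ea}
      (C : Category o ℓ e) (U : SetFunctor C c) (P : BinaryProducts C) (F : Functor C C) →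
    let open Setup C U P F in
    (λ' : IndexedMorphism) →
    (∀ X → IndexedMorphism.λ₀ λ' X ≡[ X ] ≐ ≡[ Functor.F₀ F X ]) →
    (K : Conformance λ') →
    (A : Category oa ℓa ea) (S : Functor C (op A)) (T : Functor (op A) C) → S ⊣ T →
    (L : Functor A A) (I : InitialAlgebra L)
    (δ : NaturalTransformation (F ∘F T) (T ∘F opF L)) →
    HasLeftAdjoint (Eq ∘F T) →
    let open Logic T L I δ in
    Adequate λ' K
      × (Injective _≡_ _≡_ (SetFunctor.map U (NaturalTransformation.η δ (InitialAlgebra.𝒜 I)))
         → Expressive λ' K)
theorem3 C U P F λ' λ-≡ K _ _ T _ L I δ (_ , adj) =
  adequate λ' λ-≡ adj K ,
  λ δ-inj α th th-eq → adequate λ' λ-≡ adj K α th th-eq , Ker-theoryMap⊆𝟙 λ' λ-≡ K δ-inj α th-eq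
  where open TheoryMaps C U P F T L I δ
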